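{- $g^4(C_2^2)=4$, $g^4(C_2^3)=5$, $g^4(C_2^4)=7$, $g^4(C_2^5)=8$ and $g^4(C_2^6)=10$.
   Context: $C_2^r$ denotes the elementary abelian $2$-group of rank $r$. For a finite abelian group $G$ (written additively) and a positive integer $k$, the $k$-Harborth constant $g^k(G)$ is the smallest positive integer $t$ such that every subset $S\subseteq G$ with $|S|\ge t$ contains a subset $T$ with $|T|=k$ and $\sum_{x\in T}x=0$. -}

module Defs where

open import Data.Nat using (ℕ; suc; _≤_)
open import Data.Bool using (Bool; false; _xor_)
open import Data.Vec using (Vec; replicate; zipWith)
open import Data.List using (List; foldr; length)
open import Data.List.Relation.Unary.Unique.Propositional using (Unique)
open import Data.List.Relation.Binary.Sublist.Propositional using (_⊆_)
open import Data.Product using (Σ; _×_; ∃-syntax)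
open import Relation.Binary.PropositionalEquality using (_≡_)

C₂^ : ℕ → Set
C₂^ r = Vec Bool r

0G : ∀ {r} → C₂^ r
0G {r} = replicate r false

_⊕_ : ∀ {r} → C₂^ r → C₂^ r → C₂^ r
_⊕_ = zipWith _xor_

Σ⊕ : ∀ {r} → List (C₂^ r) → C₂^ r
Σ⊕ {r} = foldr _⊕_ 0G

-- A finite subset S of G is represented by a duplicate-free list; |S| = length.
-- A subset T of S is a sublist of S (automatically duplicate-free).
HarborthProp : ℕ → ℕ → ℕ → Set
HarborthProp k r t =
  (S : List (C₂^ r)) → Unique S → t ≤ length S →
  ∃[ T ] (T ⊆ S × length T ≡ k × Σ⊕ T ≡ 0G)

IsHarborthConst : ℕ → ℕ → ℕ → Set
IsHarborthConst k r t =
  1 ≤ t × HarborthProp k r t × ((t' : ℕ) → 1 ≤ t' → HarborthProp k r t' → t ≤ t')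

-- Any set S ⊆ C₂^r is, after translating by one of its elements x₀ and choosing a basis of
-- the span of S - x₀ greedily among its elements, the image under an injective affine map
-- C₂^k → C₂^r (k ≤ r) of a set containing 0 and the k unit vectors. An affine map sends
-- zero-sum sets of even size to zero-sum sets, because the translations cancel in pairs.
-- So the upper bounds reduce to such normalised sets in C₂^k, k ≤ r, which a backtracking
-- search over C₂^k settles; the lower bounds are explicit sets of size g⁴(C₂^r) - 1 with
-- no zero-sum 4-subset.
module Submission where

open import Defs
open import Algebra.Bundles using (CommutativeMonoid)
open import Algebra.Structures using (IsCommutativeMonoid)
import Algebra.Properties.CommutativeSemigroup as CommutativeSemigroupProperties
open import Data.Bool using (Bool; true; false; T; _∧_; _∨_; _xor_; if_then_else_)
open import Data.Bool.Properties
  using (T-∧; T-∨; xor-assoc; xor-comm; xor-identityˡ; xor-identityʳ; xor-same)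
  renaming (_≟_ to _≟ᵇ_)
open import Data.Empty using (⊥-elim)
open import Data.List using (List; []; _∷_; _++_; [_]; map; length; filter)
open import Data.List.Properties using (length-++; length-map; map-∘; map-cong)
open import Data.List.Membership.Propositional using (_∈_; find; lose)
open import Data.List.Membership.Propositional.Properties
  using (∈-++⁺ˡ; ∈-++⁺ʳ; ∈-++⁻; ∈-map⁺; ∈-map⁻; ∈-∃++; ∈-filter⁺; ∈-filter⁻)
import Data.List.Membership.DecPropositional as DecMembership
open import Data.List.Relation.Binary.Subset.Propositional using () renaming (_⊆_ to _⊆ₛ_)
import Data.List.Relation.Binary.Subset.Propositional.Properties as Subset
open import Data.List.Relation.Binary.Sublist.Propositional
  using (_⊆_; []; _∷_; _∷ʳ_; lookup; minimum)
open import Data.List.Relation.Binary.Sublist.Propositional.Properties using (length-mono-≤; filter-⊆)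
open import Data.List.Relation.Binary.Permutation.Propositional
  using (_↭_; ↭-refl; ↭-sym; ↭-trans; ↭-prep; ↭⇒↭ₛ)
open import Data.List.Relation.Binary.Permutation.Propositional.Properties
  using (∈-resp-↭; ↭-length; shift)
import Data.List.Relation.Binary.Permutation.Setoid.Properties as Permutation
open import Data.List.Relation.Unary.All using (All; []; all?)
import Data.List.Relation.Unary.All as All
open import Data.List.Relation.Unary.Any using (Any; here; there; any?; satisfied; tail)
open import Data.List.Relation.Unary.AllPairs using ([]; _∷_)
open import Data.List.Relation.Unary.Unique.Propositional using (Unique)
import Data.List.Relation.Unary.Unique.Propositional.Properties as Unique
import Data.List.Relation.Unary.Unique.DecPropositional as DecUnique
open import Data.Nat using (ℕ; zero; suc; _+_; _*_; _∸_; _^_; _≤_; _<_; _<ᵇ_; z≤n; s≤s; _≤?_)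
open import Data.Nat.Properties
  using ( +-identityʳ; ≤-trans; ≤-pred; <⇒≱; ≮⇒≥; ≰⇒>; <ᵇ⇒<; suc-injective; ^-monoʳ-<
        ; m≤n⇒m<n∨m≡n; m≤n+o⇒m∸n≤o)
open import Data.Product using (_×_; _,_; proj₁; proj₂; ∃-syntax)
open import Data.Sum using (inj₁; inj₂)
open import Data.Unit using (tt)
open import Data.Vec using (Vec; []; _∷_)
open import Data.Vec.Properties
  using (≡-dec; zipWith-assoc; zipWith-comm; zipWith-identityˡ; zipWith-identityʳ)
open import Function using (Injective; Equivalence)
open import Level using (0ℓ)
open import Relation.Binary using (DecidableEquality)
open import Relation.Binary.PropositionalEquality
  using (_≡_; refl; sym; trans; cong; cong₂; subst; subst₂; setoid; isEquivalence; module ≡-Reasoning)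
open import Relation.Nullary using (Dec; yes; no; ¬_; ¬?)
open import Relation.Nullary.Decidable using (True; isYes; toWitness; map′; _×-dec_)

private
  variable
    k n r t : ℕ
    S : List (C₂^ r)

⊕-isCommutativeMonoid : IsCommutativeMonoid _≡_ (_⊕_ {r}) 0G
⊕-isCommutativeMonoid = record
  { isMonoid = record
    { isSemigroup = record
      { isMagma = record { isEquivalence = isEquivalence ; ∙-cong = cong₂ _⊕_ }
      ; assoc = zipWith-assoc xor-assoc
      }
    ; identity = zipWith-identityˡ xor-identityˡ , zipWith-identityʳ xor-identityʳ
    }
  ; comm = zipWith-comm xor-comm
  }

⊕-commutativeMonoid : ℕ → CommutativeMonoid 0ℓ 0ℓ
⊕-commutativeMonoid r = record { isCommutativeMonoid = ⊕-isCommutativeMonoid {r} }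

module ⊕ {r : ℕ} where
  open CommutativeMonoid (⊕-commutativeMonoid r) public using (assoc; comm; identityˡ; identityʳ)
  open CommutativeSemigroupProperties (CommutativeMonoid.commutativeSemigroup (⊕-commutativeMonoid r))
    public using (interchange)

⊕-self : (x : C₂^ r) → x ⊕ x ≡ 0G
⊕-self [] = refl
⊕-self (β ∷ x) = cong₂ _∷_ (xor-same β) (⊕-self x)

x⊕[x⊕y]≡y : (x y : C₂^ r) → x ⊕ (x ⊕ y) ≡ y
x⊕[x⊕y]≡y x y = begin
  x ⊕ (x ⊕ y)  ≡⟨ ⊕.assoc x x y ⟨
  (x ⊕ x) ⊕ y  ≡⟨ cong (_⊕ y) (⊕-self x) ⟩
  0G ⊕ y       ≡⟨ ⊕.identityˡ y ⟩
  y            ∎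
  where open ≡-Reasoning

⊕-cancelˡ : (x : C₂^ r) {y z : C₂^ r} → x ⊕ y ≡ x ⊕ z → y ≡ z
⊕-cancelˡ x {y} {z} e = trans (sym (x⊕[x⊕y]≡y x y)) (trans (cong (x ⊕_) e) (x⊕[x⊕y]≡y x z))

⊕-transpose : {x y z : C₂^ r} → x ⊕ y ≡ z → y ⊕ z ≡ x
⊕-transpose {x = x} {y} e = trans (cong (y ⊕_) (trans (sym e) (⊕.comm x y))) (x⊕[x⊕y]≡y y x)

_≟ᵥ_ : DecidableEquality (C₂^ r)
_≟ᵥ_ = ≡-dec _≟ᵇ_

Σ⊕-↭ : {T U : List (C₂^ r)} → T ↭ U → Σ⊕ T ≡ Σ⊕ U
Σ⊕-↭ p = Permutation.foldr-commMonoid (setoid _) ⊕-isCommutativeMonoid (↭⇒↭ₛ p)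

Σ⊕-map-⊕ˡ : (x : C₂^ r) (n : ℕ) (T : List (C₂^ r)) → length T ≡ n * 2 → Σ⊕ (map (x ⊕_) T) ≡ Σ⊕ T
Σ⊕-map-⊕ˡ x zero [] _ = refl
Σ⊕-map-⊕ˡ x (suc n) (a ∷ b ∷ T) l = begin
  (x ⊕ a) ⊕ ((x ⊕ b) ⊕ Σ⊕ (map (x ⊕_) T))
    ≡⟨ cong (λ s → (x ⊕ a) ⊕ ((x ⊕ b) ⊕ s)) (Σ⊕-map-⊕ˡ x n T (suc-injective (suc-injective l))) ⟩
  (x ⊕ a) ⊕ ((x ⊕ b) ⊕ Σ⊕ T)  ≡⟨ cong ((x ⊕ a) ⊕_) (⊕.assoc x b (Σ⊕ T)) ⟩
  (x ⊕ a) ⊕ (x ⊕ (b ⊕ Σ⊕ T))  ≡⟨ ⊕.interchange x a x (b ⊕ Σ⊕ T) ⟩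
  (x ⊕ x) ⊕ (a ⊕ (b ⊕ Σ⊕ T))  ≡⟨ cong (_⊕ (a ⊕ (b ⊕ Σ⊕ T))) (⊕-self x) ⟩
  0G ⊕ (a ⊕ (b ⊕ Σ⊕ T))       ≡⟨ ⊕.identityˡ _ ⟩
  a ⊕ (b ⊕ Σ⊕ T)              ∎
  where open ≡-Reasoning

allVectors : ∀ k → List (C₂^ k)
allVectors zero = [ [] ]
allVectors (suc k) = map (false ∷_) (allVectors k) ++ map (true ∷_) (allVectors k)

∈-allVectors : (v : C₂^ k) → v ∈ allVectors k
∈-allVectors [] = here refl
∈-allVectors (false ∷ v) = ∈-++⁺ˡ (∈-map⁺ (false ∷_) (∈-allVectors v))
∈-allVectors (true ∷ v) = ∈-++⁺ʳ _ (∈-map⁺ (true ∷_) (∈-allVectors v))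

allVectors-unique : ∀ k → Unique (allVectors k)
allVectors-unique zero = [] ∷ []
allVectors-unique (suc k) =
  Unique.++⁺ (Unique.map⁺ ∷-injective (allVectors-unique k))
             (Unique.map⁺ ∷-injective (allVectors-unique k))
             disjoint
  where
  ∷-injective : {β : Bool} {u v : C₂^ k} → _≡_ {A = C₂^ (suc k)} (β ∷ u) (β ∷ v) → u ≡ v
  ∷-injective refl = refl
  disjoint : {v : C₂^ (suc k)} → ¬ (v ∈ map (false ∷_) (allVectors k) × v ∈ map (true ∷_) (allVectors k))
  disjoint (p , q) with ∈-map⁻ (false ∷_) p | ∈-map⁻ (true ∷_) q
  ... | _ , _ , refl | _ , _ , ()

length-allVectors : ∀ k → length (allVectors k) ≡ 2 ^ k
length-allVectors zero = refl
length-allVectors (suc k) = begin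
  length (map (false ∷_) (allVectors k) ++ map (true ∷_) (allVectors k))
    ≡⟨ length-++ (map (false ∷_) (allVectors k)) ⟩
  length (map (false ∷_) (allVectors k)) + length (map (true ∷_) (allVectors k))
    ≡⟨ cong₂ _+_ (length-map (false ∷_) (allVectors k)) (length-map (true ∷_) (allVectors k)) ⟩
  length (allVectors k) + length (allVectors k)
    ≡⟨ cong₂ _+_ (length-allVectors k) (trans (length-allVectors k) (sym (+-identityʳ (2 ^ k)))) ⟩
  2 ^ suc k ∎
  where open ≡-Reasoning

module _ {A : Set} (_≟_ : DecidableEquality A) where
  open DecMembership _≟_ using (_∈?_)

  unique-⊆ₛ⇒sublist-↭ : (S : List A) {T : List A} → Unique T → T ⊆ₛ S → ∃[ U ] (U ⊆ S × U ↭ T)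
  unique-⊆ₛ⇒sublist-↭ [] {[]} _ _ = [] , [] , ↭-refl
  unique-⊆ₛ⇒sublist-↭ [] {x ∷ T} _ T⊆S with () ← T⊆S (here refl)
  unique-⊆ₛ⇒sublist-↭ (y ∷ S) {T} uT T⊆yS with y ∈? T
  ... | no y∉T =
    let U , U⊆S , U↭T = unique-⊆ₛ⇒sublist-↭ S uT (λ z∈T → tail (λ { refl → y∉T z∈T }) (T⊆yS z∈T))
    in U , y ∷ʳ U⊆S , U↭T
  ... | yes y∈T with a , b , refl ← ∈-∃++ y∈T
                with y≢ ∷ uab ← Permutation.Unique-resp-↭ (setoid A) (↭⇒↭ₛ (shift y a b)) uT =
    let U , U⊆S , U↭ab = unique-⊆ₛ⇒sublist-↭ S uab ab⊆S
    in y ∷ U , refl ∷ U⊆S , ↭-trans (↭-prep y U↭ab) (↭-sym (shift y a b))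
    where
    ab⊆S : a ++ b ⊆ₛ S
    ab⊆S z∈ab = tail (λ { refl → All.lookup y≢ z∈ab refl })
      (T⊆yS (∈-resp-↭ (↭-sym (shift y a b)) (there z∈ab)))

  unique-⊆ₛ⇒length-≤ : (S : List A) {T : List A} → Unique T → T ⊆ₛ S → length T ≤ length S
  unique-⊆ₛ⇒length-≤ S uT T⊆S =
    let U , U⊆S , U↭T = unique-⊆ₛ⇒sublist-↭ S uT T⊆S
    in subst (_≤ length S) (↭-length U↭T) (length-mono-≤ U⊆S)

-- Unlike in HarborthProp, T need only consist of members of S, not be a sublist of it.
ZeroSumSubset : ℕ → List (C₂^ r) → Set
ZeroSumSubset n S = ∃[ T ] (Unique T × T ⊆ₛ S × length T ≡ n × Σ⊕ T ≡ 0G)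

ZeroSumSubset-mono : {S S′ : List (C₂^ r)} → S ⊆ₛ S′ → ZeroSumSubset n S → ZeroSumSubset n S′
ZeroSumSubset-mono S⊆S′ (T , uT , T⊆S , l , s) = T , uT , (λ z∈T → S⊆S′ (T⊆S z∈T)) , l , s

ZeroSumSubset-map : (f : C₂^ k → C₂^ r) → Injective _≡_ _≡_ f →
  (∀ T → length T ≡ n → Σ⊕ T ≡ 0G → Σ⊕ (map f T) ≡ 0G) →
  {S : List (C₂^ k)} → ZeroSumSubset n S → ZeroSumSubset n (map f S)
ZeroSumSubset-map f f-injective f-zero (T , uT , T⊆S , l , s) =
  map f T , Unique.map⁺ f-injective uT , Subset.map⁺ f T⊆S , trans (length-map f T) l , f-zero T l s

ZeroSumSubset⇒sublist : ZeroSumSubset n S → ∃[ T ] (T ⊆ S × length T ≡ n × Σ⊕ T ≡ 0G)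
ZeroSumSubset⇒sublist {S = S} (T , uT , T⊆S , l , s) =
  let U , U⊆S , U↭T = unique-⊆ₛ⇒sublist-↭ _≟ᵥ_ S uT T⊆S
  in U , U⊆S , trans (↭-length U↭T) l , trans (Σ⊕-↭ U↭T) s

injection⇒≤ : (f : C₂^ k → C₂^ r) → Injective _≡_ _≡_ f → k ≤ r
injection⇒≤ {k} {r} f f-injective = ≮⇒≥ λ r<k → <⇒≱ (^-monoʳ-< 2 (s≤s (s≤s z≤n)) r<k) 2^k≤2^r
  where
  2^k≤2^r : 2 ^ k ≤ 2 ^ r
  2^k≤2^r = subst₂ _≤_ (trans (length-map f (allVectors k)) (length-allVectors k)) (length-allVectors r)
    (unique-⊆ₛ⇒length-≤ _≟ᵥ_ (allVectors r) (Unique.map⁺ f-injective (allVectors-unique k))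
      (λ {v} _ → ∈-allVectors v))

lincomb : Vec (C₂^ r) k → C₂^ k → C₂^ r
lincomb [] [] = 0G
lincomb (b ∷ B) (β ∷ c) = (if β then b else 0G) ⊕ lincomb B c

lincomb-0G : (B : Vec (C₂^ r) k) → lincomb B 0G ≡ 0G
lincomb-0G [] = refl
lincomb-0G (b ∷ B) = trans (⊕.identityˡ (lincomb B 0G)) (lincomb-0G B)

lincomb-⊕ : (B : Vec (C₂^ r) k) (c c′ : C₂^ k) → lincomb B (c ⊕ c′) ≡ lincomb B c ⊕ lincomb B c′
lincomb-⊕ [] [] [] = sym (⊕.identityˡ 0G)
lincomb-⊕ (b ∷ B) (β ∷ c) (β′ ∷ c′) =
  trans (cong₂ _⊕_ (select-xor β β′) (lincomb-⊕ B c c′)) (⊕.interchange _ _ (lincomb B c) (lincomb B c′))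
  where
  select-xor : ∀ β β′ → (if β xor β′ then b else 0G) ≡ (if β then b else 0G) ⊕ (if β′ then b else 0G)
  select-xor false β′ = sym (⊕.identityˡ _)
  select-xor true false = sym (⊕.identityʳ b)
  select-xor true true = sym (⊕-self b)

Σ⊕-map-lincomb : (B : Vec (C₂^ r) k) (T : List (C₂^ k)) → Σ⊕ (map (lincomb B) T) ≡ lincomb B (Σ⊕ T)
Σ⊕-map-lincomb B [] = sym (lincomb-0G B)
Σ⊕-map-lincomb B (c ∷ T) =
  trans (cong (lincomb B c ⊕_) (Σ⊕-map-lincomb B T)) (sym (lincomb-⊕ B c (Σ⊕ T)))

Σ⊕-map-affine : (x₀ : C₂^ r) (B : Vec (C₂^ r) k) (n : ℕ) (T : List (C₂^ k)) → length T ≡ n * 2 →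
  Σ⊕ (map (λ c → x₀ ⊕ lincomb B c) T) ≡ lincomb B (Σ⊕ T)
Σ⊕-map-affine x₀ B n T l = begin
  Σ⊕ (map (λ c → x₀ ⊕ lincomb B c) T)     ≡⟨ cong Σ⊕ (map-∘ T) ⟩
  Σ⊕ (map (x₀ ⊕_) (map (lincomb B) T))
    ≡⟨ Σ⊕-map-⊕ˡ x₀ n (map (lincomb B) T) (trans (length-map (lincomb B) T) l) ⟩
  Σ⊕ (map (lincomb B) T)                 ≡⟨ Σ⊕-map-lincomb B T ⟩
  lincomb B (Σ⊕ T)                       ∎
  where open ≡-Reasoning

InSpan : Vec (C₂^ r) k → C₂^ r → Set
InSpan B b = ∃[ c ] lincomb B c ≡ b

inSpan? : (B : Vec (C₂^ r) k) (b : C₂^ r) → Dec (InSpan B b)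
inSpan? {k = k} B b =
  map′ satisfied (λ (c , e) → lose (∈-allVectors c) e) (any? (λ c → lincomb B c ≟ᵥ b) (allVectors k))

lincomb-∷-injective : (B : Vec (C₂^ r) k) (b : C₂^ r) → Injective _≡_ _≡_ (lincomb B) → ¬ InSpan B b →
  Injective _≡_ _≡_ (lincomb (b ∷ B))
lincomb-∷-injective B b inj b∉ {false ∷ c} {false ∷ c′} e = cong (false ∷_) (inj (⊕-cancelˡ 0G e))
lincomb-∷-injective B b inj b∉ {true ∷ c} {true ∷ c′} e = cong (true ∷_) (inj (⊕-cancelˡ b e))
lincomb-∷-injective B b inj b∉ {true ∷ c} {false ∷ c′} e =
  ⊥-elim (b∉ (c ⊕ c′ , trans (lincomb-⊕ B c c′) (⊕-transpose (trans e (⊕.identityˡ _)))))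
lincomb-∷-injective B b inj b∉ {false ∷ c} {true ∷ c′} e =
  ⊥-elim (b∉ (c′ ⊕ c , trans (lincomb-⊕ B c′ c) (⊕-transpose (trans (sym e) (⊕.identityˡ _)))))

unitVectors : ∀ k → List (C₂^ k)
unitVectors zero = []
unitVectors (suc k) = (true ∷ 0G) ∷ map (false ∷_) (unitVectors k)

frame : ∀ k → List (C₂^ k)
frame k = 0G ∷ unitVectors k

length-unitVectors : ∀ k → length (unitVectors k) ≡ k
length-unitVectors zero = refl
length-unitVectors (suc k) =
  cong suc (trans (length-map (false ∷_) (unitVectors k)) (length-unitVectors k))

record AffineChart (x₀ : C₂^ r) (S : List (C₂^ r)) : Set where
  field
    dim : ℕ
    basis : Vec (C₂^ r) dim
    coords : List (C₂^ dim)
    image : map (λ c → x₀ ⊕ lincomb basis c) coords ≡ S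
    unitVectors⊆coords : unitVectors dim ⊆ₛ coords
    lincomb-injective : Injective _≡_ _≡_ (lincomb basis)

module _ {x₀ : C₂^ r} {S : List (C₂^ r)} (chart : AffineChart x₀ S) (x : C₂^ r) where
  open AffineChart chart

  extendChart-inSpan : InSpan basis (x₀ ⊕ x) → AffineChart x₀ (x ∷ S)
  extendChart-inSpan (c , e) = record
    { dim = dim
    ; basis = basis
    ; coords = c ∷ coords
    ; image = cong₂ _∷_ (trans (cong (x₀ ⊕_) e) (x⊕[x⊕y]≡y x₀ x)) image
    ; unitVectors⊆coords = λ u∈ → there (unitVectors⊆coords u∈)
    ; lincomb-injective = lincomb-injective
    }

  extendChart-newBasis : ¬ InSpan basis (x₀ ⊕ x) → AffineChart x₀ (x ∷ S)
  extendChart-newBasis x∉ = record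
    { dim = suc dim
    ; basis = (x₀ ⊕ x) ∷ basis
    ; coords = (true ∷ 0G) ∷ map (false ∷_) coords
    ; image = cong₂ _∷_ new-point old-points
    ; unitVectors⊆coords = λ where
        (here refl) → here refl
        (there u∈) → there (Subset.map⁺ (false ∷_) unitVectors⊆coords u∈)
    ; lincomb-injective = lincomb-∷-injective basis (x₀ ⊕ x) lincomb-injective x∉
    }
    where
    open ≡-Reasoning
    new-point : x₀ ⊕ ((x₀ ⊕ x) ⊕ lincomb basis 0G) ≡ x
    new-point = begin
      x₀ ⊕ ((x₀ ⊕ x) ⊕ lincomb basis 0G) ≡⟨ cong (λ y → x₀ ⊕ ((x₀ ⊕ x) ⊕ y)) (lincomb-0G basis) ⟩
      x₀ ⊕ ((x₀ ⊕ x) ⊕ 0G)               ≡⟨ cong (x₀ ⊕_) (⊕.identityʳ (x₀ ⊕ x)) ⟩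
      x₀ ⊕ (x₀ ⊕ x)                      ≡⟨ x⊕[x⊕y]≡y x₀ x ⟩
      x                                  ∎
    old-points : map (λ c → x₀ ⊕ lincomb ((x₀ ⊕ x) ∷ basis) c) (map (false ∷_) coords) ≡ S
    old-points = begin
      map (λ c → x₀ ⊕ lincomb ((x₀ ⊕ x) ∷ basis) c) (map (false ∷_) coords)
        ≡⟨ map-∘ coords ⟨
      map (λ c → x₀ ⊕ (0G ⊕ lincomb basis c)) coords
        ≡⟨ map-cong (λ c → cong (x₀ ⊕_) (⊕.identityˡ (lincomb basis c))) coords ⟩
      map (λ c → x₀ ⊕ lincomb basis c) coords
        ≡⟨ image ⟩
      S ∎

affineChart : (x₀ : C₂^ r) (S : List (C₂^ r)) → AffineChart x₀ S
affineChart x₀ [] = record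
  { dim = 0 ; basis = [] ; coords = [] ; image = refl ; unitVectors⊆coords = λ ()
  ; lincomb-injective = λ { {[]} {[]} _ → refl } }
affineChart x₀ (x ∷ S) with chart ← affineChart x₀ S
  with inSpan? (AffineChart.basis chart) (x₀ ⊕ x)
... | yes x∈ = extendChart-inSpan chart x x∈
... | no x∉ = extendChart-newBasis chart x x∉

FramedHarborthProp : ℕ → ℕ → ℕ → Set
FramedHarborthProp n k t =
  (S : List (C₂^ k)) → Unique S → t ≤ length S → frame k ⊆ₛ S → ZeroSumSubset n S

harborth-upperBound : (n : ℕ) → (∀ k → k ≤ r → FramedHarborthProp (n * 2) k (suc t)) →
  HarborthProp (n * 2) r (suc t)
harborth-upperBound n framed [] _ ()
harborth-upperBound {r} {t} n framed (x₀ ∷ S) uS t<S =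
  ZeroSumSubset⇒sublist (subst (ZeroSumSubset (n * 2)) chart-image
    (ZeroSumSubset-map chart chart-injective chart-zeroSum coords-zeroSum))
  where
  open AffineChart (affineChart x₀ S)
  chart : C₂^ dim → C₂^ r
  chart c = x₀ ⊕ lincomb basis c
  chart-injective : Injective _≡_ _≡_ chart
  chart-injective e = lincomb-injective (⊕-cancelˡ x₀ e)
  chart-image : map chart (0G ∷ coords) ≡ x₀ ∷ S
  chart-image = cong₂ _∷_ (trans (cong (x₀ ⊕_) (lincomb-0G basis)) (⊕.identityʳ x₀)) image
  unique : Unique (0G ∷ coords)
  unique = Unique.map⁻ (subst Unique (sym chart-image) uS)
  t<coords : suc t ≤ length (0G ∷ coords)
  t<coords = subst (suc t ≤_) (trans (cong length (sym chart-image)) (length-map chart (0G ∷ coords)))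
    t<S
  frame⊆coords : frame dim ⊆ₛ 0G ∷ coords
  frame⊆coords (here refl) = here refl
  frame⊆coords (there u∈) = there (unitVectors⊆coords u∈)
  coords-zeroSum : ZeroSumSubset (n * 2) (0G ∷ coords)
  coords-zeroSum =
    framed dim (injection⇒≤ (lincomb basis) lincomb-injective) (0G ∷ coords) unique t<coords frame⊆coords
  chart-zeroSum : ∀ T → length T ≡ n * 2 → Σ⊕ T ≡ 0G → Σ⊕ (map chart T) ≡ 0G
  chart-zeroSum T l s =
    trans (Σ⊕-map-affine x₀ basis n T l) (trans (cong (lincomb basis) s) (lincomb-0G basis))

sublists : {A : Set} → ℕ → List A → List (List A)
sublists zero xs = [ [] ]
sublists (suc n) [] = []
sublists (suc n) (x ∷ xs) = map (x ∷_) (sublists n xs) ++ sublists (suc n) xs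

∈-sublists⁺ : {A : Set} {T xs : List A} → T ⊆ xs → T ∈ sublists (length T) xs
∈-sublists⁺ [] = here refl
∈-sublists⁺ {T = []} (y ∷ʳ T⊆xs) = here refl
∈-sublists⁺ {T = _ ∷ _} (y ∷ʳ T⊆xs) = ∈-++⁺ʳ _ (∈-sublists⁺ T⊆xs)
∈-sublists⁺ (refl ∷ T⊆xs) = ∈-++⁺ˡ (∈-map⁺ _ (∈-sublists⁺ T⊆xs))

∈-sublists⁻ : {A : Set} (n : ℕ) (xs : List A) {T : List A} → T ∈ sublists n xs → T ⊆ xs × length T ≡ n
∈-sublists⁻ zero xs (here refl) = minimum xs , refl
∈-sublists⁻ (suc n) (x ∷ xs) T∈ with ∈-++⁻ (map (x ∷_) (sublists n xs)) T∈
... | inj₁ T∈map with T′ , T′∈ , refl ← ∈-map⁻ (x ∷_) T∈map =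
  let T′⊆xs , l = ∈-sublists⁻ n xs T′∈ in refl ∷ T′⊆xs , cong suc l
... | inj₂ T∈rest = let T⊆xs , l = ∈-sublists⁻ (suc n) xs T∈rest in x ∷ʳ T⊆xs , l

closesZeroSum? : (m : ℕ) (x : C₂^ k) (chosen : List (C₂^ k)) →
  Dec (Any (λ T → Σ⊕ (x ∷ T) ≡ 0G × Unique (x ∷ T)) (sublists m chosen))
closesZeroSum? m x chosen =
  any? (λ T → (Σ⊕ (x ∷ T) ≟ᵥ 0G) ×-dec DecUnique.unique? _≟ᵥ_ (x ∷ T)) (sublists m chosen)

closesZeroSum-sound : (m : ℕ) (x : C₂^ k) (chosen : List (C₂^ k)) → True (closesZeroSum? m x chosen) →
  ZeroSumSubset (suc m) (x ∷ chosen)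
closesZeroSum-sound m x chosen ok with T , T∈ , (s , u) ← find (toWitness ok) =
  let T⊆chosen , l = ∈-sublists⁻ m chosen T∈
  in x ∷ T , u , Subset.∷⁺ʳ x (λ z∈T → lookup T⊆chosen z∈T) , cong suc l , s

shift-⊆ₛ : {A : Set} (x : A) (xs ys : List A) → x ∷ xs ++ ys ⊆ₛ xs ++ x ∷ ys
shift-⊆ₛ x xs ys = ∈-resp-↭ (↭-sym (shift x xs ys))

-- Backtracking over rest: its head x is skipped, or taken; a taken x either closes a
-- zero-sum (m+1)-set with m chosen elements or joins the chosen ones. The first disjunct
-- prunes branches where fewer than n elements remain.
searchFrom : ℕ → List (C₂^ k) → List (C₂^ k) → ℕ → Bool
searchFrom m chosen rest zero = false
searchFrom m chosen [] (suc n) = true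
searchFrom m chosen (x ∷ rest) (suc n) =
  (length rest <ᵇ n) ∨
  ((isYes (closesZeroSum? m x chosen) ∨ searchFrom m (x ∷ chosen) rest n) ∧
   searchFrom m chosen rest (suc n))

searchFrom-sound : ∀ m (chosen rest : List (C₂^ k)) n → T (searchFrom m chosen rest n) →
  {X : List (C₂^ k)} → X ⊆ rest → n ≤ length X → ZeroSumSubset (suc m) (chosen ++ X)
searchFrom-sound m chosen [] (suc n) _ [] ()
searchFrom-sound m chosen (x ∷ rest) (suc n) ok X⊆ n≤ with Equivalence.to T-∨ ok | X⊆
... | inj₁ short | _ = ⊥-elim (<⇒≱ (<ᵇ⇒< _ n short) (≤-pred (≤-trans n≤ (length-mono-≤ X⊆))))
... | inj₂ ok′ | .x ∷ʳ X⊆rest =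
  searchFrom-sound m chosen rest (suc n) (proj₂ (Equivalence.to T-∧ ok′)) X⊆rest n≤
... | inj₂ ok′ | _∷_ {xs = X} refl X⊆rest with Equivalence.to T-∨ (proj₁ (Equivalence.to T-∧ ok′))
...   | inj₁ closes =
  ZeroSumSubset-mono (λ z∈ → shift-⊆ₛ x chosen X (∈-++⁺ˡ z∈)) (closesZeroSum-sound m x chosen closes)
...   | inj₂ rec =
  ZeroSumSubset-mono (shift-⊆ₛ x chosen X)
    (searchFrom-sound m (x ∷ chosen) rest n rec X⊆rest (≤-pred n≤))

nonFrame : ∀ k → List (C₂^ k)
nonFrame k = filter (λ v → ¬? (v ∈? frame k)) (allVectors k)
  where open DecMembership _≟ᵥ_ using (_∈?_)

search : ℕ → ∀ k → ℕ → Bool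
search m k t = searchFrom m (frame k) (nonFrame k) (t ∸ suc k)

search-sound : ∀ m k t → T (search m k t) → FramedHarborthProp (suc m) k t
search-sound m k t ok S uS t≤S frame⊆S =
  ZeroSumSubset-mono L⊆S
    (searchFrom-sound m (frame k) (nonFrame k) (t ∸ suc k) ok (filter-⊆ (_∈? S) (nonFrame k)) bound)
  where
  open DecMembership _≟ᵥ_ using (_∈?_)
  X = filter (_∈? S) (nonFrame k)
  L = frame k ++ X
  S⊆L : S ⊆ₛ L
  S⊆L {v} v∈S with v ∈? frame k
  ... | yes v∈frame = ∈-++⁺ˡ v∈frame
  ... | no v∉frame = ∈-++⁺ʳ (frame k) (∈-filter⁺ (_∈? S) v∈nonFrame v∈S)
    where
    v∈nonFrame : v ∈ nonFrame k
    v∈nonFrame = ∈-filter⁺ (λ w → ¬? (w ∈? frame k)) (∈-allVectors v) v∉frame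
  L⊆S : L ⊆ₛ S
  L⊆S v∈L with ∈-++⁻ (frame k) v∈L
  ... | inj₁ v∈frame = frame⊆S v∈frame
  ... | inj₂ v∈X = proj₂ (∈-filter⁻ (_∈? S) {xs = nonFrame k} v∈X)
  |S|≤|L| : length S ≤ suc k + length X
  |S|≤|L| = subst (length S ≤_)
    (trans (length-++ (frame k)) (cong (λ l → suc l + length X) (length-unitVectors k)))
    (unique-⊆ₛ⇒length-≤ _≟ᵥ_ L uS S⊆L)
  bound : t ∸ suc k ≤ length X
  bound = m≤n+o⇒m∸n≤o t (suc k) (≤-trans t≤S |S|≤|L|)

harborth-lowerBound : (n : ℕ) (S : List (C₂^ r)) → Unique S → All (λ T → ¬ Σ⊕ T ≡ 0G) (sublists n S) →
  HarborthProp n r t → length S < t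
harborth-lowerBound {t = t} n S uS zero-sum-free H with t ≤? length S
... | no t≰ = ≰⇒> t≰
... | yes t≤ with T , T⊆S , l , s ← H S uS t≤ =
  ⊥-elim (All.lookup zero-sum-free (subst (λ m → T ∈ sublists m S) l (∈-sublists⁺ T⊆S)) s)

searchUpTo : ℕ → ℕ → ℕ → Bool
searchUpTo m zero t = search m zero t
searchUpTo m (suc r) t = search m (suc r) t ∧ searchUpTo m r t

searchUpTo-sound : ∀ m r t → T (searchUpTo m r t) → ∀ k → k ≤ r → FramedHarborthProp (suc m) k t
searchUpTo-sound m zero t ok zero z≤n = search-sound m zero t ok
searchUpTo-sound m (suc r) t ok k k≤1+r with Equivalence.to T-∧ ok | m≤n⇒m<n∨m≡n k≤1+r
... | ok-r , _ | inj₂ refl = search-sound m (suc r) t ok-r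
... | _ , ok-<r | inj₁ k<1+r = searchUpTo-sound m r t ok-<r k (≤-pred k<1+r)

isHarborthConst-4 : (S : List (C₂^ r)) → T (searchUpTo 3 r (suc (length S))) →
  True (DecUnique.unique? _≟ᵥ_ S) → True (all? (λ T → ¬? (Σ⊕ T ≟ᵥ 0G)) (sublists 4 S)) →
  IsHarborthConst 4 r (suc (length S))
isHarborthConst-4 S ok uS zero-sum-free =
  s≤s z≤n ,
  harborth-upperBound 2 (searchUpTo-sound 3 _ _ ok) ,
  λ t _ H → harborth-lowerBound 4 S (toWitness uS) (toWitness zero-sum-free) H

theorem3p9 : IsHarborthConst 4 2 4 × IsHarborthConst 4 3 5 × IsHarborthConst 4 4 7 × IsHarborthConst 4 5 8 × IsHarborthConst 4 6 10
theorem3p9 =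
  isHarborthConst-4 (frame 2) tt tt tt ,
  isHarborthConst-4 (frame 3) tt tt tt ,
  isHarborthConst-4 (frame 4 ++ [ true ∷ true ∷ true ∷ true ∷ [] ]) tt tt tt ,
  isHarborthConst-4 (frame 5 ++ [ false ∷ true ∷ true ∷ true ∷ true ∷ [] ]) tt tt tt ,
  isHarborthConst-4
    (frame 6 ++ (false ∷ false ∷ true ∷ true ∷ true ∷ true ∷ [])
              ∷ (true ∷ true ∷ false ∷ false ∷ true ∷ true ∷ []) ∷ [])
    tt tt tt
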